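{- Let $\lambda=(\lambda_1\ge\dots\ge\lambda_r)$ be a partition with $s(\lambda)=0$. Then at least one of the following holds: \begin{enumerate} \item $\lambda$ is a staircase up to some number of additional boxes in the first column, i.e. $\lambda=(m,m-1,\dots,2,1,1^{a})$ for some integers $m\ge0$, $a\ge0$ (that is, the staircase $(m,\dots,1)$ followed by $a$ additional parts equal to $1$). \item There is an index $i^*$ such that peeling a horizontal domino from each row $i\le i^*$, i.e. passing to $(\lambda_1-2,\dots,\lambda_{i^*}-2,\lambda_{i^*+1},\dots,\lambda_r)$ (with zero parts removed), yields the staircase of $\lambda$. \end{enumerate}
   Context: Partitions are identified with their Young diagrams (row $i$ has $\lambda_i$ boxes, left-aligned). A skew shape $\gamma$ can be peeled from $\lambda$ if there is a partition $\lambda'\subseteq\lambda$ such that $\lambda/\lambda'$ equals $\gamma$ after deleting empty rows and columns. A domino is a $1\times2$ (horizontal) or $2\times1$ (vertical) block. The domino number $d(\lambda)$ is the maximum number of dominos that can be peeled successively from $\lambda$; the resulting partition is always the same staircase $(k,k-1,\dots,1)$, called the staircase of $\lambda$. The non-vanishing tetrominos are the following nine 4-box skew shapes (coordinates (row, column), up to deleting empty rows/columns): a single row of 4 boxes; the $2\times2$ square; $\{(1,2),(2,1),(2,2),(3,1)\}$ (the shape $(2,2,1)/(1)$); $\{(1,1),(1,2),(1,3),(2,1)\}$ (the shape $(3,1)$); $\{(1,3),(2,1),(2,2),(2,3)\}$ (the shape $(3,3)/(2)$); and the four shapes consisting of two dominos lying in disjoint rows and disjoint columns, one strictly north-east of the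 other, in any of the four combinations of orientations (horizontal/horizontal, vertical/vertical, horizontal north-east with vertical south-west, vertical north-east with horizontal south-west). The non-vanishing tetromino number $s(\lambda)$ is the maximum $s$ such that there is a chain of partitions $\lambda=\lambda^0\supseteq\lambda^1\supseteq\dots\supseteq\lambda^s$ with each $\lambda^{i-1}/\lambda^i$ a non-vanishing tetromino. -}

module Defs where

open import Data.Nat using (ℕ; zero; suc; _+_; _∸_; _≤_; _<_; _≥_; _≟_; _<?_)
open import Data.Product using (_×_; _,_; proj₁; proj₂; Σ)
open import Data.List using (List; []; _∷_; _++_; map; length; filter; upTo; take; drop; replicate)
open import Data.List.Relation.Unary.All using (All)
open import Data.List.Relation.Unary.Linked using (Linked)
open import Data.List.Membership.Propositional using (_∈_)
open import Data.List.Membership.DecPropositional _≟_ using (_∈?_)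
open import Data.Sum using (_⊎_)
open import Relation.Binary.PropositionalEquality using (_≡_)

IsPartition : List ℕ → Set
IsPartition la = Linked _≥_ la × All (λ x → 0 < x) la

data _⊆ₚ_ : List ℕ → List ℕ → Set where
  []⊆  : ∀ {la} → [] ⊆ₚ la
  ∷⊆   : ∀ {m l ms ls} → m ≤ l → ms ⊆ₚ ls → (m ∷ ms) ⊆ₚ (l ∷ ls)

-- Boxes (row , column), 0-indexed.
Box : Set
Box = ℕ × ℕ

range : ℕ → ℕ → List ℕ
range m l = map (m +_) (upTo (l ∸ m))

skewFrom : ℕ → List ℕ → List ℕ → List Box
skewFrom i [] _ = []
skewFrom i (l ∷ ls) [] = map (i ,_) (range 0 l) ++ skewFrom (suc i) ls []
skewFrom i (l ∷ ls) (m ∷ ms) = map (i ,_) (range m l) ++ skewFrom (suc i) ls ms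

skew : List ℕ → List ℕ → List Box
skew la mu = skewFrom 0 la mu

-- Deleting empty rows and columns: a row index r becomes the number of
-- occupied rows strictly above it (likewise for columns).
rank : List ℕ → ℕ → ℕ
rank xs r = length (filter (λ x → x ∈? xs) (upTo r))

compress : List Box → List Box
compress bs = map (λ b → rank (map proj₁ bs) (proj₁ b) , rank (map proj₂ bs) (proj₂ b)) bs

SameSet : List Box → List Box → Set
SameSet xs ys = ∀ b → (b ∈ xs → b ∈ ys) × (b ∈ ys → b ∈ xs)

ShapeIs : List Box → List Box → Set
ShapeIs bs g = SameSet (compress bs) g

hDomino vDomino : List Box
hDomino = (0 , 0) ∷ (0 , 1) ∷ []
vDomino = (0 , 0) ∷ (1 , 0) ∷ []

IsDomino : List Box → Set
IsDomino bs = ShapeIs bs hDomino ⊎ ShapeIs bs vDomino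

t-row t-square t-221/1 t-31 t-33/2 t-hh t-vv t-hv t-vh : List Box
t-row    = (0 , 0) ∷ (0 , 1) ∷ (0 , 2) ∷ (0 , 3) ∷ []
t-square = (0 , 0) ∷ (0 , 1) ∷ (1 , 0) ∷ (1 , 1) ∷ []
t-221/1  = (0 , 1) ∷ (1 , 0) ∷ (1 , 1) ∷ (2 , 0) ∷ []
t-31     = (0 , 0) ∷ (0 , 1) ∷ (0 , 2) ∷ (1 , 0) ∷ []
t-33/2   = (0 , 2) ∷ (1 , 0) ∷ (1 , 1) ∷ (1 , 2) ∷ []
-- two dominos, one strictly north-east of the other, disjoint rows and columns
t-hh     = (0 , 2) ∷ (0 , 3) ∷ (1 , 0) ∷ (1 , 1) ∷ []
t-vv     = (0 , 1) ∷ (1 , 1) ∷ (2 , 0) ∷ (3 , 0) ∷ []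
t-hv     = (0 , 1) ∷ (0 , 2) ∷ (1 , 0) ∷ (2 , 0) ∷ []
t-vh     = (0 , 2) ∷ (1 , 2) ∷ (2 , 0) ∷ (2 , 1) ∷ []

IsNVTetromino : List Box → Set
IsNVTetromino bs =
  ShapeIs bs t-row ⊎ ShapeIs bs t-square ⊎ ShapeIs bs t-221/1 ⊎ ShapeIs bs t-31 ⊎
  ShapeIs bs t-33/2 ⊎ ShapeIs bs t-hh ⊎ ShapeIs bs t-vv ⊎ ShapeIs bs t-hv ⊎ ShapeIs bs t-vh

Peel : (List Box → Set) → List ℕ → List ℕ → Set
Peel P la mu = IsPartition mu × mu ⊆ₚ la × P (skew la mu)

data Chain (P : List Box → Set) : List ℕ → List ℕ → ℕ → Set where
  done : ∀ {la} → Chain P la la 0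
  step : ∀ {la mu nu n} → Peel P la mu → Chain P mu nu n → Chain P la nu (suc n)

-- s(la) = 0 : every chain of non-vanishing tetromino peels has length 0
-- (i.e. the maximum length s(la) equals 0).
TetNumberZero : List ℕ → Set
TetNumberZero la = ∀ nu n → Chain IsNVTetromino la nu n → n ≡ 0

StaircaseOf : List ℕ → List ℕ → Set
StaircaseOf la nu =
  Σ ℕ λ d → Chain IsDomino la nu d × (∀ nu' m → Chain IsDomino la nu' m → m ≤ d)

stair : ℕ → List ℕ
stair zero = []
stair (suc m) = suc m ∷ stair m

peelRows : ℕ → List ℕ → List ℕ
peelRows k la = filter (λ x → 0 <? x) (map (_∸ 2) (take k la) ++ drop k la)

-- Build the partition from the bottom row up. If the rows below the first admit a
-- non-vanishing tetromino peel, so does the whole partition. Otherwise, inductively,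
-- they form a staircase followed by a column of 1s, or a raised staircase (a
-- staircase with two extra boxes on each of its top i rows), or nothing; comparing
-- the new first row with the second either keeps the partition in one of these
-- families or exhibits an explicit tetromino. A raised staircase reaches its
-- underlying staircase by peeling the extra boxes as i horizontal dominos, and no
-- domino chain is longer: each domino removes 2 boxes and preserves the 2-core, and
-- a partition with 2-core stair k has at least k(k+1)/2 boxes.

module Submission where

open import Defs
open import Data.Nat using (ℕ; _≤_; _≥_)
open import Data.List using (List; _++_; replicate; take; length)
open import Data.List.Relation.Unary.All using (All)
open import Data.Product using (_×_; Σ)
open import Data.Sum using (_⊎_)
open import Relation.Binary.PropositionalEquality using (_≡_)

open import Data.Nat using (zero; suc; _+_; _∸_; _*_; _<_; _≟_; _<?_; _≤?_; z≤n; s≤s)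
open import Data.Nat.Properties
open import Data.Nat.ListAction using (sum)
open import Algebra.Properties.CommutativeSemigroup +-commutativeSemigroup using (x∙yz≈y∙xz)
open import Data.Parity.Base as ℙ using (Parity; 0ℙ; 1ℙ; _⁻¹)
open import Data.Parity.Properties using (⁻¹-selfInverse; suc-homo-⁻¹; p⁻¹+p≡1ℙ; p+p≡0ℙ)
open import Data.Nat.Base using (parity)
open import Data.Product using (_,_; proj₁; proj₂)
open import Data.List using ([]; _∷_; map; filter; upTo; drop; [_])
open import Data.List.Properties
  using (upTo-∷ʳ; filter-++; length-++; filter-accept; filter-reject; filter-all; map-∘; map-cong; map-++; ++-identityʳ; ++-assoc)
open import Data.List.Relation.Unary.Linked using (Linked; []; [-]; _∷_)
import Data.List.Relation.Unary.Linked as Linked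
open import Data.List.Relation.Unary.All using ([]; _∷_)
import Data.List.Relation.Unary.All as All
open import Data.List.Relation.Unary.Any using (here; there)
open import Data.List.Membership.Propositional using (_∈_; _∉_)
open import Data.List.Membership.Propositional.Properties
  using (∈-map⁺; ∈-map⁻; ∈-++⁺ˡ; ∈-++⁺ʳ; ∈-++⁻; ∈-upTo⁺; ∈-upTo⁻)
open import Data.List.Membership.DecPropositional _≟_ using (_∈?_)
open import Data.Sum using (inj₁; inj₂)
open import Data.Empty using (⊥-elim)
open import Relation.Nullary using (yes; no)
open import Relation.Binary.PropositionalEquality using (refl; sym; trans; cong; cong₂; subst; module ≡-Reasoning)
open import Relation.Binary.Definitions using (tri<; tri≈; tri>)
open import Function using (id; _∘′_)

row : List ℕ → ℕ → ℕ
row []       _       = 0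
row (x ∷ xs) zero    = x
row (x ∷ xs) (suc j) = row xs j

row-suc : ∀ xs j → row xs (suc j) ≡ row (drop 1 xs) j
row-suc []       j = refl
row-suc (x ∷ xs) j = refl

row-tail≤head : ∀ {x xs} → Linked _≥_ (x ∷ xs) → row xs 0 ≤ x
row-tail≤head [-]     = z≤n
row-tail≤head (p ∷ _) = p

linked-∷ : ∀ {x xs} → row xs 0 ≤ x → Linked _≥_ xs → Linked _≥_ (x ∷ xs)
linked-∷ _ []       = [-]
linked-∷ p [-]      = p ∷ [-]
linked-∷ p (q ∷ xs) = p ∷ q ∷ xs

row-suc-≤ : ∀ {xs} → Linked _≥_ xs → ∀ j → row xs (suc j) ≤ row xs j
row-suc-≤ []       j       = z≤n
row-suc-≤ [-]      j       = z≤n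
row-suc-≤ (p ∷ xs) zero    = p
row-suc-≤ (p ∷ xs) (suc j) = row-suc-≤ xs j

row-antimono : ∀ {xs} → Linked _≥_ xs → ∀ {i j} → i ≤ j → row xs j ≤ row xs i
row-antimono {xs} L {i} i≤j with m≤n⇒∃[o]m+o≡n i≤j
... | k , refl = go k
  where
  go : ∀ k → row xs (i + k) ≤ row xs i
  go zero    rewrite +-identityʳ i = ≤-refl
  go (suc k) rewrite +-suc i k = ≤-trans (row-suc-≤ L (i + k)) (go k)

row-ext : ∀ xs ys → All (0 <_) xs → All (0 <_) ys → (∀ j → row xs j ≡ row ys j) → xs ≡ ys
row-ext []       []       _        _        _ = refl
row-ext []       (y ∷ ys) _        (y>0 ∷ _) h = ⊥-elim (<-irrefl (h 0) y>0)
row-ext (x ∷ xs) []       (x>0 ∷ _) _       h = ⊥-elim (<-irrefl (sym (h 0)) x>0)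
row-ext (x ∷ xs) (y ∷ ys) (_ ∷ xs>0) (_ ∷ ys>0) h =
  cong₂ _∷_ (h 0) (row-ext xs ys xs>0 ys>0 (λ j → h (suc j)))

⊆ₚ-row : ∀ {mu la} → mu ⊆ₚ la → ∀ j → row mu j ≤ row la j
⊆ₚ-row []⊆       j       = z≤n
⊆ₚ-row (∷⊆ p _)  zero    = p
⊆ₚ-row (∷⊆ _ s)  (suc j) = ⊆ₚ-row s j

⊆ₚ-refl : ∀ xs → xs ⊆ₚ xs
⊆ₚ-refl []       = []⊆
⊆ₚ-refl (x ∷ xs) = ∷⊆ ≤-refl (⊆ₚ-refl xs)

++⁺-⊆ₚ : ∀ P {X Y} → Y ⊆ₚ X → (P ++ Y) ⊆ₚ (P ++ X)
++⁺-⊆ₚ []      s = s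
++⁺-⊆ₚ (p ∷ P) s = ∷⊆ ≤-refl (++⁺-⊆ₚ P s)

prefix-⊆ₚ : ∀ Q X → Q ⊆ₚ (Q ++ X)
prefix-⊆ₚ []      X = []⊆
prefix-⊆ₚ (q ∷ Q) X = ∷⊆ ≤-refl (prefix-⊆ₚ Q X)

partition-tail : ∀ {x xs} → IsPartition (x ∷ xs) → IsPartition xs
partition-tail (xs↓ , _ ∷ xs>0) = Linked.tail xs↓ , xs>0

partition-∷ : ∀ {x xs} → row xs 0 ≤ x → 0 < x → IsPartition xs → IsPartition (x ∷ xs)
partition-∷ xs≤x x>0 (xs↓ , xs>0) = linked-∷ xs≤x xs↓ , x>0 ∷ xs>0

row-++ : ∀ Q X → row Q 0 ≤ row (Q ++ X) 0
row-++ []      X = z≤n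
row-++ (q ∷ Q) X = ≤-refl

partition-prefix : ∀ Q X → IsPartition (Q ++ X) → IsPartition Q
partition-prefix []      X _             = [] , []
partition-prefix (q ∷ Q) X P@(Q↓ , q>0 ∷ _) =
  partition-∷ (≤-trans (row-++ Q X) (row-tail≤head Q↓)) q>0 (partition-prefix Q X (partition-tail P))

row-replace : ∀ Q S {a b} → b ≤ a → row (Q ++ b ∷ S) 0 ≤ row (Q ++ a ∷ S) 0
row-replace []      S b≤a = b≤a
row-replace (q ∷ Q) S _   = ≤-refl

partition-replace : ∀ Q S {a b} → IsPartition (Q ++ a ∷ S) → b ≤ a → row S 0 ≤ b → 0 < b → IsPartition (Q ++ b ∷ S)
partition-replace []      S P                b≤a S≤b b>0 = partition-∷ S≤b b>0 (partition-tail P)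
partition-replace (q ∷ Q) S P@(Q↓ , q>0 ∷ _) b≤a S≤b b>0 =
  partition-∷ (≤-trans (row-replace Q S b≤a) (row-tail≤head Q↓)) q>0 (partition-replace Q S (partition-tail P) b≤a S≤b b>0)

rank-suc : ∀ xs y → rank xs (suc y) ≡ rank xs y + length (filter (_∈? xs) [ y ])
rank-suc xs y = begin
  length (filter (_∈? xs) (upTo (suc y)))                   ≡⟨ cong (length ∘′ filter (_∈? xs)) (sym (upTo-∷ʳ y)) ⟩
  length (filter (_∈? xs) (upTo y ++ [ y ]))                ≡⟨ cong length (filter-++ (_∈? xs) (upTo y) [ y ]) ⟩
  length (filter (_∈? xs) (upTo y) ++ filter (_∈? xs) [ y ]) ≡⟨ length-++ (filter (_∈? xs) (upTo y)) ⟩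
  rank xs y + length (filter (_∈? xs) [ y ])                ∎
  where open ≡-Reasoning

rank-suc-∈ : ∀ xs y → y ∈ xs → rank xs (suc y) ≡ suc (rank xs y)
rank-suc-∈ xs y y∈ = trans (rank-suc xs y)
  (trans (cong (λ l → rank xs y + length l) (filter-accept (_∈? xs) {xs = []} y∈)) (+-comm _ 1))

rank-suc-∉ : ∀ xs y → y ∉ xs → rank xs (suc y) ≡ rank xs y
rank-suc-∉ xs y y∉ = trans (rank-suc xs y)
  (trans (cong (λ l → rank xs y + length l) (filter-reject (_∈? xs) {xs = []} y∉)) (+-identityʳ _))

rank-mono-≤ : ∀ xs {y z} → y ≤ z → rank xs y ≤ rank xs z
rank-mono-≤ xs {y} y≤z with m≤n⇒∃[o]m+o≡n y≤z
... | k , refl = go k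
  where
  go : ∀ k → rank xs y ≤ rank xs (y + k)
  go zero    rewrite +-identityʳ y = ≤-refl
  go (suc k) rewrite +-suc y k with y + k ∈? xs
  ... | yes p = ≤-trans (go k) (≤-trans (n≤1+n _) (≤-reflexive (sym (rank-suc-∈ xs (y + k) p))))
  ... | no p  = ≤-trans (go k) (≤-reflexive (sym (rank-suc-∉ xs (y + k) p)))

rank-pos : ∀ xs {x y} → x ∈ xs → x < y → 1 ≤ rank xs y
rank-pos xs {x} x∈ x<y = ≤-trans (s≤s z≤n) (≤-trans (≤-reflexive (sym (rank-suc-∈ xs x x∈))) (rank-mono-≤ xs x<y))

rank≥2 : ∀ xs {x₁ x₂ y} → x₁ ∈ xs → x₂ ∈ xs → x₁ < x₂ → x₂ < y → 2 ≤ rank xs y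
rank≥2 xs {x₂ = x₂} x₁∈ x₂∈ x₁<x₂ x₂<y =
  ≤-trans (s≤s (rank-pos xs x₁∈ x₁<x₂)) (≤-trans (≤-reflexive (sym (rank-suc-∈ xs x₂ x₂∈))) (rank-mono-≤ xs x₂<y))

rank-≡0 : ∀ xs y → All (y ≤_) xs → rank xs y ≡ 0
rank-≡0 xs zero    _    = refl
rank-≡0 xs (suc y) y≤xs =
  trans (rank-suc-∉ xs y (λ y∈ → 1+n≰n (All.lookup y≤xs y∈))) (rank-≡0 xs y (All.map (≤-trans (n≤1+n y)) y≤xs))

rank-gap : ∀ xs y g → All (λ x → x < y ⊎ y + g ≤ x) xs → rank xs (y + g) ≡ rank xs y
rank-gap xs y zero    _   rewrite +-identityʳ y = refl
rank-gap xs y (suc g) out rewrite +-suc y g =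
  trans (rank-suc-∉ xs (y + g) notIn) (rank-gap xs y g (All.map widen out))
  where
  notIn : y + g ∉ xs
  notIn y+g∈ with All.lookup out y+g∈
  ... | inj₁ y+g<y  = <⇒≱ y+g<y (m≤m+n y g)
  ... | inj₂ y+1+g≤ = 1+n≰n y+1+g≤
  widen : ∀ {x} → x < y ⊎ suc (y + g) ≤ x → x < y ⊎ y + g ≤ x
  widen (inj₁ x<y)     = inj₁ x<y
  widen (inj₂ y+1+g≤x) = inj₂ (≤-trans (n≤1+n _) y+1+g≤x)

rank-map-suc : ∀ xs r → rank (map suc xs) (suc r) ≡ rank xs r
rank-map-suc xs zero = rank-suc-∉ (map suc xs) 0 0∉
  where
  0∉ : 0 ∉ map suc xs
  0∉ p with ∈-map⁻ suc p
  ... | _ , _ , ()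
rank-map-suc xs (suc r) with r ∈? xs
... | yes p = trans (rank-suc-∈ (map suc xs) (suc r) (∈-map⁺ suc p))
                    (trans (cong suc (rank-map-suc xs r)) (sym (rank-suc-∈ xs r p)))
... | no p  = trans (rank-suc-∉ (map suc xs) (suc r) suc-r∉)
                    (trans (rank-map-suc xs r) (sym (rank-suc-∉ xs r p)))
  where
  suc-r∉ : suc r ∉ map suc xs
  suc-r∉ q with ∈-map⁻ suc q
  ... | _ , r∈ , refl = p r∈

down : Box → Box
down (r , c) = suc r , c

compress-map-down : ∀ bs → compress (map down bs) ≡ compress bs
compress-map-down bs =
  trans (sym (map-∘ bs))
    (map-cong (λ { (r , c) → cong₂ _,_ (trans (cong (λ l → rank l (suc r)) rows) (rank-map-suc (map proj₁ bs) r))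
                                        (cong (λ l → rank l c) cols) }) bs)
  where
  rows : map proj₁ (map down bs) ≡ map suc (map proj₁ bs)
  rows = trans (sym (map-∘ bs)) (map-∘ bs)
  cols : map proj₂ (map down bs) ≡ map proj₂ bs
  cols = sym (map-∘ bs)

skewFrom-∷ : ∀ i l ls mu → skewFrom i (l ∷ ls) mu ≡ map (i ,_) (range (row mu 0) l) ++ skewFrom (suc i) ls (drop 1 mu)
skewFrom-∷ i l ls []       = refl
skewFrom-∷ i l ls (m ∷ mu) = refl

skewFrom-suc : ∀ i la mu → skewFrom (suc i) la mu ≡ map down (skewFrom i la mu)
skewFrom-suc i []       mu = refl
skewFrom-suc i (l ∷ ls) mu
  rewrite skewFrom-∷ (suc i) l ls mu | skewFrom-∷ i l ls mu
        | map-++ down (map (i ,_) (range (row mu 0) l)) (skewFrom (suc i) ls (drop 1 mu))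
        | skewFrom-suc (suc i) ls (drop 1 mu) =
  cong (_++ map down (skewFrom (suc i) ls (drop 1 mu))) (map-∘ {g = down} {f = i ,_} (range (row mu 0) l))

ShapeIs-skew-∷ : ∀ l ls ms → ShapeIs (skew (l ∷ ls) (l ∷ ms)) ≡ ShapeIs (skew ls ms)
ShapeIs-skew-∷ l ls ms rewrite n∸n≡0 l | skewFrom-suc 0 ls ms | compress-map-down (skew ls ms) = refl

∈-range⁻ : ∀ {m l c} → c ∈ range m l → m ≤ c × c < l
∈-range⁻ {m} {l} p with ∈-map⁻ (m +_) p
... | k , k∈ , refl with ∈-upTo⁻ k∈ | m ≤? l
... | k< | yes m≤l = m≤m+n m k , ≤-trans (+-monoʳ-< m k<) (≤-reflexive (m+[n∸m]≡n m≤l))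
... | k< | no m≰l  rewrite m≤n⇒m∸n≡0 (<⇒≤ (≰⇒> m≰l)) with () ← k<

∈-range⁺ : ∀ {m l c} → m ≤ c → c < l → c ∈ range m l
∈-range⁺ {m} {l} m≤c c<l =
  subst (_∈ range m l) (m+[n∸m]≡n m≤c) (∈-map⁺ (m +_) (∈-upTo⁺ (∸-monoˡ-< c<l m≤c)))

range-+ : ∀ c k → range c (k + c) ≡ map (_+ c) (upTo k)
range-+ c k rewrite m+n∸n≡m k c = map-cong (λ x → +-comm c x) (upTo k)

∈-skewFrom⁻ : ∀ i la mu {r c} → (r , c) ∈ skewFrom i la mu →
  Σ ℕ λ j → r ≡ i + j × row mu j ≤ c × c < row la j
∈-skewFrom⁻ i (l ∷ ls) mu {c = c} p rewrite skewFrom-∷ i l ls mu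
  with ∈-++⁻ (map (i ,_) (range (row mu 0) l)) p
... | inj₁ q with ∈-map⁻ (i ,_) q
...   | _ , c∈ , refl = 0 , sym (+-identityʳ i) , ∈-range⁻ c∈
∈-skewFrom⁻ i (l ∷ ls) mu {c = c} p | inj₂ q with ∈-skewFrom⁻ (suc i) ls (drop 1 mu) q
... | j , r≡ , m≤c , c<l = suc j , trans r≡ (sym (+-suc i j)) , subst (_≤ c) (sym (row-suc mu j)) m≤c , c<l

∈-skewFrom⁺ : ∀ i la mu j {c} → row mu j ≤ c → c < row la j → (i + j , c) ∈ skewFrom i la mu
∈-skewFrom⁺ i (l ∷ ls) mu zero    m≤c c<l rewrite skewFrom-∷ i l ls mu | +-identityʳ i =
  ∈-++⁺ˡ (∈-map⁺ (i ,_) (∈-range⁺ m≤c c<l))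
∈-skewFrom⁺ i (l ∷ ls) mu (suc j) {c} m≤c c<l rewrite skewFrom-∷ i l ls mu | +-suc i j =
  ∈-++⁺ʳ (map (i ,_) (range (row mu 0) l))
    (∈-skewFrom⁺ (suc i) ls (drop 1 mu) j (subst (_≤ c) (row-suc mu j) m≤c) c<l)

skewFrom-self : ∀ r S → skewFrom r S S ≡ []
skewFrom-self r []      = refl
skewFrom-self r (s ∷ S) rewrite n∸n≡0 s = skewFrom-self (suc r) S

skewFrom-++ : ∀ r P X Y → skewFrom r (P ++ X) (P ++ Y) ≡ skewFrom (r + length P) X Y
skewFrom-++ r []      X Y rewrite +-identityʳ r = refl
skewFrom-++ r (p ∷ P) X Y rewrite n∸n≡0 p | +-suc r (length P) = skewFrom-++ (suc r) P X Y

skewFrom-prefix : ∀ r Q X → skewFrom r (Q ++ X) Q ≡ skewFrom (r + length Q) X []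
skewFrom-prefix r Q X = trans (cong (skewFrom r (Q ++ X)) (sym (++-identityʳ Q))) (skewFrom-++ r Q X [])

skewFrom-∷ʳ0 : ∀ r X Y → skewFrom r X (Y ++ 0 ∷ []) ≡ skewFrom r X Y
skewFrom-∷ʳ0 r []      Y       = refl
skewFrom-∷ʳ0 r (x ∷ X) []      = refl
skewFrom-∷ʳ0 r (x ∷ X) (y ∷ Y) = cong (map (r ,_) (range y x) ++_) (skewFrom-∷ʳ0 (suc r) X Y)

compress⇒ShapeIs : ∀ bs g → compress bs ≡ g → ShapeIs bs g
compress⇒ShapeIs bs g refl b = id , id

skew⇒ShapeIs : ∀ la mu bs g → skew la mu ≡ bs → compress bs ≡ g → ShapeIs (skew la mu) g
skew⇒ShapeIs la mu bs g refl = compress⇒ShapeIs bs g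

-- The 2-core of la is stair (coreIndex la). Only two facts about it are used:
-- removing a domino does not change it, and la has at least triangle (coreIndex la) boxes.

stepBy : Parity → ℕ → ℕ
stepBy 1ℙ k = suc k
stepBy 0ℙ k = k ∸ 1

coreStep : ℕ → ℕ → ℕ
coreStep x k = stepBy (parity x ℙ.+ parity k) k

coreIndex : List ℕ → ℕ
coreIndex []       = 0
coreIndex (x ∷ xs) = coreStep x (coreIndex xs)

triangle : ℕ → ℕ
triangle k = sum (stair k)

parity-suc : ∀ n → parity (suc n) ≡ parity n ⁻¹
parity-suc n = sym (⁻¹-selfInverse (suc-homo-⁻¹ n))

+-parity-suc : ∀ p n → p ℙ.+ parity (suc n) ≡ (p ℙ.+ parity n) ⁻¹
+-parity-suc p n rewrite parity-suc n with p
... | 0ℙ = refl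
... | 1ℙ = refl

coreStep-involutive : ∀ x k → coreStep x (coreStep x k) ≡ k
coreStep-involutive x k with parity x ℙ.+ parity k in eq
... | 1ℙ rewrite +-parity-suc (parity x) k | eq = refl
coreStep-involutive x zero    | 0ℙ rewrite eq = refl
coreStep-involutive x (suc k) | 0ℙ rewrite sym (⁻¹-selfInverse (trans (sym (+-parity-suc (parity x) k)) eq)) = refl

coreIndex-stair : ∀ m → coreIndex (stair m) ≡ m
coreIndex-stair zero = refl
coreIndex-stair (suc m) rewrite coreIndex-stair m | parity-suc m | p⁻¹+p≡1ℙ (parity m) = refl

coreIndex-bound : ∀ xs → Linked _≥_ xs → coreIndex xs ≤ row xs 0 × triangle (coreIndex xs) ≤ sum xs
coreIndex-bound []       _ = z≤n , z≤n
coreIndex-bound (x ∷ xs) L with coreIndex-bound xs (Linked.tail L)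
... | k≤row , tri≤sum with parity x ℙ.+ parity (coreIndex xs) in eq
... | 1ℙ = k<x , +-mono-≤ k<x tri≤sum
  where
  k≤x : coreIndex xs ≤ x
  k≤x = ≤-trans k≤row (row-tail≤head L)
  k<x : coreIndex xs < x
  k<x with m≤n⇒m<n∨m≡n k≤x
  ... | inj₁ lt  = lt
  ... | inj₂ refl with () ← trans (sym eq) (p+p≡0ℙ (parity x))
... | 0ℙ = ≤-trans (m∸n≤m (coreIndex xs) 1) (≤-trans k≤row (row-tail≤head L)) ,
           ≤-trans (triangle-pred (coreIndex xs)) (≤-trans tri≤sum (m≤n+m (sum xs) x))
  where
  triangle-pred : ∀ k → triangle (k ∸ 1) ≤ triangle k
  triangle-pred zero    = ≤-refl
  triangle-pred (suc k) = m≤n+m (triangle k) (suc k)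

-- Dominos.

∈hDomino⁻ : ∀ {t} → t ∈ hDomino → proj₁ t ≡ 0 × proj₂ t ≤ 1
∈hDomino⁻ (here refl)         = refl , z≤n
∈hDomino⁻ (there (here refl)) = refl , s≤s z≤n

∈vDomino⁻ : ∀ {t} → t ∈ vDomino → proj₂ t ≡ 0 × proj₁ t ≤ 1
∈vDomino⁻ (here refl)         = refl , z≤n
∈vDomino⁻ (there (here refl)) = refl , s≤s z≤n

module FirstRowDomino (la mu : List ℕ) (la↓ : Linked _≥_ la) (mu↓ : Linked _≥_ mu)
                      (mu≤la : ∀ j → row mu j ≤ row la j) where
  L M : ℕ → ℕ
  L = row la
  M = row mu

  boxes : List Box
  boxes = skew la mu

  rows cols : List ℕ
  rows = map proj₁ boxes
  cols = map proj₂ boxes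

  image : Box → Box
  image b = rank rows (proj₁ b) , rank cols (proj₂ b)

  ∈boxes⁺ : ∀ j c → M j ≤ c → c < L j → (j , c) ∈ boxes
  ∈boxes⁺ j c = ∈-skewFrom⁺ 0 la mu j

  ∈boxes⁻ : ∀ {r c} → (r , c) ∈ boxes → M r ≤ c × c < L r
  ∈boxes⁻ p with ∈-skewFrom⁻ 0 la mu p
  ... | _ , refl , bounds = bounds

  row∈ : ∀ {r c} → (r , c) ∈ boxes → r ∈ rows
  row∈ = ∈-map⁺ proj₁

  col∈ : ∀ {r c} → (r , c) ∈ boxes → c ∈ cols
  col∈ = ∈-map⁺ proj₂

  image∈ : ∀ {g} → ShapeIs boxes g → ∀ {b} → b ∈ boxes → image b ∈ g
  image∈ S {b} p = proj₁ (S (image b)) (∈-map⁺ image p)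

  preimage : ∀ {g} → ShapeIs boxes g → ∀ {t} → t ∈ g → Σ Box λ b → b ∈ boxes × t ≡ image b
  preimage S {t} p = ∈-map⁻ image (proj₂ (S t) p)

  horizontal : ShapeIs boxes hDomino → M 0 < L 0 → L 0 ≡ M 0 + 2 × (∀ j → L (suc j) ≡ M (suc j))
  horizontal S M<L = ≤-antisym L≤M+2 M+2≤L , λ j → ≤-antisym (lowerRowsFull j) (mu≤la (suc j))
    where
    corner : (0 , M 0) ∈ boxes
    corner = ∈boxes⁺ 0 (M 0) ≤-refl M<L

    lowerRowsFull : ∀ j → L (suc j) ≤ M (suc j)
    lowerRowsFull j with M (suc j) <? L (suc j)
    ... | no M≮L = ≮⇒≥ M≮L
    ... | yes M<L′ = ⊥-elim (1+n≰n (≤-trans (rank-pos rows (row∈ corner) (s≤s z≤n))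
                                     (≤-reflexive (proj₁ (∈hDomino⁻ (image∈ S (∈boxes⁺ (suc j) _ ≤-refl M<L′)))))))

    inFirstRow : ∀ {r c} → (r , c) ∈ boxes → r ≡ 0
    inFirstRow {zero}  p = refl
    inFirstRow {suc r} p with ∈boxes⁻ p
    ... | M≤c , c<L = ⊥-elim (<-irrefl refl (≤-trans c<L (≤-trans (lowerRowsFull r) M≤c)))

    onlyColumn : L 0 ≤ suc (M 0) → ∀ {c} → (0 , c) ∈ boxes → c ≡ M 0
    onlyColumn L≤ p = ≤-antisym (≤-pred (≤-trans (proj₂ (∈boxes⁻ p)) L≤)) (proj₁ (∈boxes⁻ p))

    -- the two boxes of the domino lie in distinct columns of [M 0, L 0)
    M+2≤L : M 0 + 2 ≤ L 0
    M+2≤L with preimage S (here refl) | preimage S (there (here refl))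
    ... | (r₁ , c₁) , p₁ , e₁ | (r₂ , c₂) , p₂ , e₂ with inFirstRow p₁ | inFirstRow p₂ | M 0 + 2 ≤? L 0
    ... | refl | refl | yes M+2≤L′ = M+2≤L′
    ... | refl | refl | no M+2≰L =
      ⊥-elim (0≢1+n (trans (cong proj₂ e₁) (trans (cong (rank cols) (trans (onlyColumn L≤ p₁) (sym (onlyColumn L≤ p₂))))
                                                 (sym (cong proj₂ e₂)))))
      where
      L≤ : L 0 ≤ suc (M 0)
      L≤ = ≤-pred (≤-trans (≰⇒> M+2≰L) (≤-reflexive (+-comm (M 0) 2)))

    L≤M+2 : L 0 ≤ M 0 + 2
    L≤M+2 with L 0 ≤? M 0 + 2
    ... | yes L≤M+2′ = L≤M+2′
    ... | no L≰M+2 = ⊥-elim (1+n≰n (≤-trans (rank≥2 cols (col∈ corner) (col∈ second) (n<1+n _) (≤-reflexive (+-comm 2 (M 0))))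
                                          (proj₂ (∈hDomino⁻ (image∈ S third)))))
      where
      second : (0 , suc (M 0)) ∈ boxes
      second = ∈boxes⁺ 0 (suc (M 0)) (n≤1+n _) (≤-trans (≤-reflexive (+-comm 2 (M 0))) (<⇒≤ (≰⇒> L≰M+2)))
      third : (0 , M 0 + 2) ∈ boxes
      third = ∈boxes⁺ 0 (M 0 + 2) (m≤m+n (M 0) 2) (≰⇒> L≰M+2)

  vertical : ShapeIs boxes vDomino → M 0 < L 0 →
    L 0 ≡ suc (M 0) × L 1 ≡ suc (M 0) × M 1 ≡ M 0 × (∀ j → L (2 + j) ≡ M (2 + j))
  vertical S M<L = ≤-antisym L₀≤ M<L , L₁≡ , M₁≡ , lowerRowsFull
    where
    corner : (0 , M 0) ∈ boxes
    corner = ∈boxes⁺ 0 (M 0) ≤-refl M<L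

    inColumn0 : ∀ {r c} → (r , c) ∈ boxes → rank cols c ≡ 0
    inColumn0 p = proj₁ (∈vDomino⁻ (image∈ S p))

    onlyColumn : ∀ {r c} → (r , c) ∈ boxes → c ≡ M 0
    onlyColumn {c = c} p with <-cmp c (M 0)
    ... | tri< c<M _ _ = ⊥-elim (1+n≰n (≤-trans (rank-pos cols (col∈ p) c<M) (≤-reflexive (inColumn0 corner))))
    ... | tri≈ _ c≡M _ = c≡M
    ... | tri> _ _ M<c = ⊥-elim (1+n≰n (≤-trans (rank-pos cols (col∈ corner) M<c) (≤-reflexive (inColumn0 p))))

    L₀≤ : L 0 ≤ suc (M 0)
    L₀≤ with L 0 ≤? suc (M 0)
    ... | yes L≤ = L≤
    ... | no L≰ = ⊥-elim (1+n≢n (onlyColumn (∈boxes⁺ 0 (suc (M 0)) (n≤1+n _) (≰⇒> L≰))))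

    -- the preimage of (1 , 0) lies strictly below the first row and in column M 0
    second : (1 , M 0) ∈ boxes
    second with preimage S (there (here refl))
    ... | (zero , c) , p , ()
    ... | (suc r , c) , p , _ =
      ∈boxes⁺ 1 (M 0) (row-suc-≤ mu↓ 0)
        (≤-trans (subst (λ c → suc c ≤ L (suc r)) (onlyColumn p) (proj₂ (∈boxes⁻ p))) (row-antimono la↓ (s≤s z≤n)))

    L₁≡ : L 1 ≡ suc (M 0)
    L₁≡ = ≤-antisym (≤-trans (row-suc-≤ la↓ 0) L₀≤) (proj₂ (∈boxes⁻ second))

    M₁≡ : M 1 ≡ M 0
    M₁≡ with M 1 <? M 0
    ... | yes M₁<M₀ =
      ⊥-elim (<-irrefl (onlyColumn (∈boxes⁺ 1 (M 1) ≤-refl (≤-trans (s≤s (row-suc-≤ mu↓ 0)) (≤-reflexive (sym L₁≡))))) M₁<M₀)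
    ... | no M₁≮M₀ = ≤-antisym (row-suc-≤ mu↓ 0) (≮⇒≥ M₁≮M₀)

    lowerRowsFull : ∀ j → L (2 + j) ≡ M (2 + j)
    lowerRowsFull j with M (2 + j) <? L (2 + j)
    ... | yes M<L′ = ⊥-elim (1+n≰n (≤-trans (rank≥2 rows (row∈ corner) (row∈ second) (s≤s z≤n) (s≤s (s≤s z≤n)))
                                          (proj₂ (∈vDomino⁻ (image∈ S (∈boxes⁺ (2 + j) _ ≤-refl M<L′))))))
    ... | no M≮L = ≤-antisym (≮⇒≥ M≮L) (mu≤la (2 + j))

DominoEffect : List ℕ → List ℕ → Set
DominoEffect la mu = sum la ≡ 2 + sum mu × coreIndex la ≡ coreIndex mu

dominoEffect-∷ : ∀ x la mu → DominoEffect la mu → DominoEffect (x ∷ la) (x ∷ mu)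
dominoEffect-∷ x la mu (size , core) = trans (cong (x +_) size) (x∙yz≈y∙xz x 2 (sum mu)) , cong (coreStep x) core

dominoEffect-horizontal : ∀ ls mu → All (0 <_) ls → All (0 <_) mu → (∀ j → row ls j ≡ row mu (suc j)) →
  DominoEffect (row mu 0 + 2 ∷ ls) mu
dominoEffect-horizontal ls []       ls>0 _          rows with row-ext ls [] ls>0 [] rows
... | refl = refl , refl
dominoEffect-horizontal ls (m ∷ ms) ls>0 (_ ∷ ms>0) rows with row-ext ls ms ls>0 ms>0 rows
... | refl rewrite +-comm m 2 = refl , refl

dominoEffect-vertical : ∀ ls mu → All (0 <_) ls → All (0 <_) mu →
  row ls 0 ≡ suc (row mu 0) → row mu 1 ≡ row mu 0 → (∀ j → row ls (suc j) ≡ row mu (2 + j)) →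
  DominoEffect (suc (row mu 0) ∷ ls) mu
dominoEffect-vertical (l ∷ ls) []           (_ ∷ ls>0) _ refl _ rows with row-ext ls [] ls>0 [] rows
... | refl = refl , refl
dominoEffect-vertical (l ∷ ls) (m ∷ [])     _ (m>0 ∷ _) _ m≡0 _ = ⊥-elim (<-irrefl m≡0 m>0)
dominoEffect-vertical (l ∷ ls) (m ∷ m ∷ ms) (_ ∷ ls>0) (_ ∷ _ ∷ ms>0) refl refl rows with row-ext ls ms ls>0 ms>0 rows
... | refl = cong suc (+-suc m (m + sum ms)) ,
             trans (coreStep-involutive (suc m) (coreIndex ms)) (sym (coreStep-involutive m (coreIndex ms)))

peelDomino-effect : ∀ la mu → IsPartition la → Peel IsDomino la mu → DominoEffect la mu
peelDomino-effect [] mu _ (_ , _ , inj₁ S) with () ← proj₂ (S (0 , 0)) (here refl)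
peelDomino-effect [] mu _ (_ , _ , inj₂ S) with () ← proj₂ (S (0 , 0)) (here refl)
peelDomino-effect (l ∷ ls) mu (la↓ , la>0) ((mu↓ , mu>0) , mu⊆la , D) with row mu 0 <? l
peelDomino-effect (l ∷ ls) [] (_ , l>0 ∷ _) _ | no 0≮l = ⊥-elim (0≮l l>0)
peelDomino-effect (l ∷ ls) (m ∷ ms) (la↓ , _ ∷ ls>0) ((mu↓ , _ ∷ ms>0) , ∷⊆ m≤l ms⊆ls , D) | no m≮l
  with ≤-antisym m≤l (≮⇒≥ m≮l)
... | refl = dominoEffect-∷ m ls ms
  (peelDomino-effect ls ms (Linked.tail la↓ , ls>0)
    ((Linked.tail mu↓ , ms>0) , ms⊆ls , subst (λ shape → shape hDomino ⊎ shape vDomino) (ShapeIs-skew-∷ m ls ms) D))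
peelDomino-effect (l ∷ ls) mu (la↓ , _ ∷ ls>0) ((mu↓ , mu>0) , mu⊆la , inj₁ S) | yes M<l
  with FirstRowDomino.horizontal (l ∷ ls) mu la↓ mu↓ (⊆ₚ-row mu⊆la) S M<l
... | l≡ , rows = subst (λ l → DominoEffect (l ∷ ls) mu) (sym l≡) (dominoEffect-horizontal ls mu ls>0 mu>0 rows)
peelDomino-effect (l ∷ ls) mu (la↓ , _ ∷ ls>0) ((mu↓ , mu>0) , mu⊆la , inj₂ S) | yes M<l
  with FirstRowDomino.vertical (l ∷ ls) mu la↓ mu↓ (⊆ₚ-row mu⊆la) S M<l
... | l≡ , l₁≡ , m₁≡ , rows =
  subst (λ l → DominoEffect (l ∷ ls) mu) (sym l≡) (dominoEffect-vertical ls mu ls>0 mu>0 l₁≡ m₁≡ rows)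

dominoChain-effect : ∀ {la nu n} → IsPartition la → Chain IsDomino la nu n →
  sum la ≡ n * 2 + sum nu × coreIndex la ≡ coreIndex nu × IsPartition nu
dominoChain-effect la-part done = refl , refl , la-part
dominoChain-effect {la} la-part (step {mu = mu} {n = n} peel chain) with peelDomino-effect la mu la-part peel
... | size , core with dominoChain-effect (proj₁ peel) chain
... | size′ , core′ , nu-part = trans size (trans (cong (2 +_) size′) (sym (+-assoc 2 (n * 2) _))) , trans core core′ , nu-part

-- A domino chain ends in a partition with the same 2-core, hence with at least
-- triangle (coreIndex la) boxes.
dominoChain-≤ : ∀ la d → IsPartition la → sum la ≡ d * 2 + triangle (coreIndex la) →
  ∀ nu n → Chain IsDomino la nu n → n ≤ d
dominoChain-≤ la d la-part size nu n chain with dominoChain-effect la-part chain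
... | size′ , core , (nu↓ , _) =
  *-cancelʳ-≤ n d 2 (+-cancelʳ-≤ (triangle (coreIndex la)) (n * 2) (d * 2)
    (≤-trans (+-monoʳ-≤ (n * 2) triangle≤sum) (≤-reflexive (trans (sym size′) size))))
  where
  triangle≤sum : triangle (coreIndex la) ≤ sum nu
  triangle≤sum = subst (λ k → triangle k ≤ sum nu) (sym core) (proj₂ (coreIndex-bound nu nu↓))

horizontalDomino : ∀ P c S → IsDomino (skew (P ++ 2 + c ∷ S) (P ++ c ∷ S))
horizontalDomino P c S =
  inj₁ (skew⇒ShapeIs (P ++ 2 + c ∷ S) (P ++ c ∷ S) ((length P , c) ∷ (length P , suc c) ∷ []) hDomino boxes shape)
  where
  boxes : skew (P ++ 2 + c ∷ S) (P ++ c ∷ S) ≡ (length P , c) ∷ (length P , suc c) ∷ []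
  boxes rewrite skewFrom-++ 0 P (2 + c ∷ S) (c ∷ S) | range-+ c 2 | skewFrom-self (suc (length P)) S = refl
  shape : compress ((length P , c) ∷ (length P , suc c) ∷ []) ≡ hDomino
  shape rewrite rank-≡0 (length P ∷ length P ∷ []) (length P) (≤-refl ∷ ≤-refl ∷ [])
              | rank-suc-∈ (c ∷ suc c ∷ []) c (here refl)
              | rank-≡0 (c ∷ suc c ∷ []) c (≤-refl ∷ n≤1+n c ∷ []) = refl

-- Raised staircases.

row-stair : ∀ k → row (stair k) 0 ≡ k
row-stair zero    = refl
row-stair (suc k) = refl

stair-partition : ∀ k → IsPartition (stair k)
stair-partition zero    = [] , []
stair-partition (suc k) = partition-∷ (≤-trans (≤-reflexive (row-stair k)) (n≤1+n k)) (s≤s z≤n) (stair-partition k)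

descending : ℕ → ℕ → List ℕ
descending t zero    = []
descending t (suc i) = t + i ∷ descending t i

-- The staircase stair (u + i ∸ 1) with two boxes added to each of its first i rows
-- (for u = 0 the i-th of these rows consists of the two added boxes only).
raised : ℕ → ℕ → List ℕ
raised u i = descending (2 + u) i ++ stair (u ∸ 1)

row-raised : ∀ u i → row (raised u i) 0 ≤ suc (u + i)
row-raised u zero    = ≤-trans (≤-reflexive (row-stair (u ∸ 1))) (≤-trans (m∸n≤m u 1) (≤-trans (m≤m+n u 0) (n≤1+n _)))
row-raised u (suc i) rewrite +-suc u i = ≤-refl

raised-partition : ∀ u i → IsPartition (raised u i)
raised-partition u zero    = stair-partition (u ∸ 1)
raised-partition u (suc i) = partition-∷ (≤-trans (row-raised u i) (n≤1+n _)) (s≤s z≤n) (raised-partition u i)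

descending-∷ʳ : ∀ t i → descending t (suc i) ≡ descending (suc t) i ++ t ∷ []
descending-∷ʳ t zero    rewrite +-identityʳ t = refl
descending-∷ʳ t (suc i) rewrite +-suc t i = cong (suc (t + i) ∷_) (descending-∷ʳ t i)

raised-suc : ∀ u i → raised u (suc i) ≡ descending (3 + u) i ++ 2 + u ∷ stair (u ∸ 1)
raised-suc u i = trans (cong (_++ stair (u ∸ 1)) (descending-∷ʳ (2 + u) i))
                       (++-assoc (descending (3 + u) i) (2 + u ∷ []) (stair (u ∸ 1)))

-- The lowest raised row loses its two extra boxes.
peel-raised : ∀ u i → Peel IsDomino (raised u (suc i)) (raised (suc u) i)
peel-raised u i = subst (λ la → Peel IsDomino la (raised (suc u) i)) (sym (raised-suc u i))
  (raised-partition (suc u) i , contained u , domino u)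
  where
  P : List ℕ
  P = descending (3 + u) i
  contained : ∀ u → (P ++ stair u) ⊆ₚ (P ++ 2 + u ∷ stair (u ∸ 1))
  contained zero    = ++⁺-⊆ₚ P []⊆
  contained (suc u) = ++⁺-⊆ₚ P (∷⊆ (≤-trans (n≤1+n _) (n≤1+n _)) (⊆ₚ-refl (stair u)))
  domino : ∀ u → IsDomino (skew (P ++ 2 + u ∷ stair (u ∸ 1)) (P ++ stair u))
  domino zero    = subst IsDomino (trans (cong (skew (P ++ 2 ∷ [])) (cong (_++ 0 ∷ []) (sym (++-identityʳ P))))
                                         (skewFrom-∷ʳ0 0 (P ++ 2 ∷ []) (P ++ [])))
                                  (horizontalDomino P 0 [])
  domino (suc u) = horizontalDomino P (suc u) (stair u)

raised-dominoChain : ∀ u i → Chain IsDomino (raised u i) (stair (u + i ∸ 1)) i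
raised-dominoChain u zero    rewrite +-identityʳ u = done
raised-dominoChain u (suc i) rewrite +-suc u i = step (peel-raised u i) (raised-dominoChain (suc u) i)

take-descending : ∀ t i X → take i (descending t i ++ X) ≡ descending t i
take-descending t zero    X = refl
take-descending t (suc i) X = cong (t + i ∷_) (take-descending t i X)

drop-descending : ∀ t i X → drop i (descending t i ++ X) ≡ X
drop-descending t zero    X = refl
drop-descending t (suc i) X = drop-descending t i X

map-∸2-descending : ∀ u i → map (_∸ 2) (descending (2 + u) i) ≡ descending u i
map-∸2-descending u zero    = refl
map-∸2-descending u (suc i) = cong (u + i ∷_) (map-∸2-descending u i)

descending-++-stair : ∀ k i → descending (suc k) i ++ stair k ≡ stair (k + i)
descending-++-stair k zero    rewrite +-identityʳ k = refl
descending-++-stair k (suc i) rewrite +-suc k i = cong (suc (k + i) ∷_) (descending-++-stair k i)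

peelRows-raised : ∀ u i → peelRows i (raised u i) ≡ stair (u + i ∸ 1)
peelRows-raised u i rewrite take-descending (2 + u) i (stair (u ∸ 1)) | drop-descending (2 + u) i (stair (u ∸ 1))
                          | map-∸2-descending u i = positive u
  where
  dropZero : ∀ i → filter (0 <?_) (descending 0 i ++ []) ≡ stair (i ∸ 1)
  dropZero zero          = refl
  dropZero (suc zero)    = refl
  dropZero (suc (suc i)) = trans (filter-accept (0 <?_) {xs = descending 0 (suc i) ++ []} (s≤s z≤n))
                                 (cong (suc i ∷_) (dropZero (suc i)))
  positive : ∀ u → filter (0 <?_) (descending u i ++ stair (u ∸ 1)) ≡ stair (u + i ∸ 1)
  positive zero    = dropZero i
  positive (suc k) = trans (filter-all (0 <?_) (subst (All (0 <_)) (sym (descending-++-stair k i)) (proj₂ (stair-partition (k + i)))))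
                           (descending-++-stair k i)

staircaseOf-raised : ∀ u i → StaircaseOf (raised u i) (peelRows i (raised u i))
staircaseOf-raised u i with dominoChain-effect (raised-partition u i) (raised-dominoChain u i)
... | size , core , _ =
  i , subst (λ nu → Chain IsDomino (raised u i) nu i) (sym (peelRows-raised u i)) (raised-dominoChain u i) ,
  dominoChain-≤ (raised u i) i (raised-partition u i)
    (trans size (cong (λ k → i * 2 + triangle k) (sym (trans core (coreIndex-stair (u + i ∸ 1))))))

-- Non-vanishing tetromino peels.

peelTetromino-∷ : ∀ x la mu → row la 0 ≤ x → 0 < x → Peel IsNVTetromino la mu → Peel IsNVTetromino (x ∷ la) (x ∷ mu)
peelTetromino-∷ x la mu la≤x x>0 (mu-part , mu⊆la , tet) =
  partition-∷ (≤-trans (⊆ₚ-row mu⊆la 0) la≤x) x>0 mu-part , ∷⊆ ≤-refl mu⊆la ,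
  subst (λ shape → shape t-row ⊎ shape t-square ⊎ shape t-221/1 ⊎ shape t-31 ⊎ shape t-33/2 ⊎
                   shape t-hh ⊎ shape t-vv ⊎ shape t-hv ⊎ shape t-vh)
        (sym (ShapeIs-skew-∷ x la mu)) tet

compress-row : ∀ c → compress ((0 , c) ∷ (0 , 1 + c) ∷ (0 , 2 + c) ∷ (0 , 3 + c) ∷ []) ≡ t-row
compress-row c
  rewrite rank-suc-∈ (c ∷ 1 + c ∷ 2 + c ∷ 3 + c ∷ []) (2 + c) (there (there (here refl)))
        | rank-suc-∈ (c ∷ 1 + c ∷ 2 + c ∷ 3 + c ∷ []) (1 + c) (there (here refl))
        | rank-suc-∈ (c ∷ 1 + c ∷ 2 + c ∷ 3 + c ∷ []) c (here refl)
        | rank-≡0 (c ∷ 1 + c ∷ 2 + c ∷ 3 + c ∷ []) c (≤-refl ∷ n≤1+n c ∷ m≤n+m c 2 ∷ m≤n+m c 3 ∷ []) = refl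

peel-row : ∀ c S → IsPartition (4 + suc c ∷ S) → row S 0 ≤ suc c → Peel IsNVTetromino (4 + suc c ∷ S) (suc c ∷ S)
peel-row c S P S≤ =
  partition-∷ S≤ (s≤s z≤n) (partition-tail P) , ∷⊆ (m≤n+m _ 4) (⊆ₚ-refl S) ,
  inj₁ (skew⇒ShapeIs (4 + suc c ∷ S) (suc c ∷ S) _ t-row boxes (compress-row (suc c)))
  where
  boxes : skew (4 + suc c ∷ S) (suc c ∷ S) ≡ (0 , suc c) ∷ (0 , 2 + c) ∷ (0 , 3 + c) ∷ (0 , 4 + c) ∷ []
  boxes rewrite range-+ (suc c) 4 | skewFrom-self 1 S = refl

peel-[4] : Peel IsNVTetromino (4 ∷ []) []
peel-[4] = ([] , []) , []⊆ , inj₁ (compress⇒ShapeIs (skew (4 ∷ []) []) t-row refl)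

compress-square : ∀ c → compress ((0 , c) ∷ (0 , 1 + c) ∷ (1 , c) ∷ (1 , 1 + c) ∷ []) ≡ t-square
compress-square c
  rewrite rank-suc-∈ (c ∷ 1 + c ∷ c ∷ 1 + c ∷ []) c (here refl)
        | rank-≡0 (c ∷ 1 + c ∷ c ∷ 1 + c ∷ []) c (≤-refl ∷ n≤1+n c ∷ ≤-refl ∷ n≤1+n c ∷ []) = refl

peel-square : ∀ c S → IsPartition (2 + suc c ∷ 2 + suc c ∷ S) → row S 0 ≤ suc c →
  Peel IsNVTetromino (2 + suc c ∷ 2 + suc c ∷ S) (suc c ∷ suc c ∷ S)
peel-square c S P S≤ =
  partition-∷ ≤-refl (s≤s z≤n) (partition-∷ S≤ (s≤s z≤n) (partition-tail (partition-tail P))) ,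
  ∷⊆ (m≤n+m _ 2) (∷⊆ (m≤n+m _ 2) (⊆ₚ-refl S)) ,
  inj₂ (inj₁ (skew⇒ShapeIs (2 + suc c ∷ 2 + suc c ∷ S) (suc c ∷ suc c ∷ S) _ t-square boxes (compress-square (suc c))))
  where
  boxes : skew (2 + suc c ∷ 2 + suc c ∷ S) (suc c ∷ suc c ∷ S) ≡ (0 , suc c) ∷ (0 , 2 + c) ∷ (1 , suc c) ∷ (1 , 2 + c) ∷ []
  boxes rewrite range-+ (suc c) 2 | skewFrom-self 2 S = refl

peel-[2,2] : Peel IsNVTetromino (2 ∷ 2 ∷ []) []
peel-[2,2] = ([] , []) , []⊆ , inj₂ (inj₁ (compress⇒ShapeIs (skew (2 ∷ 2 ∷ []) []) t-square refl))

compress-221/1 : ∀ v → compress ((0 , 1 + v) ∷ (1 , v) ∷ (1 , 1 + v) ∷ (2 , v) ∷ []) ≡ t-221/1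
compress-221/1 v
  rewrite rank-suc-∈ (1 + v ∷ v ∷ 1 + v ∷ v ∷ []) v (there (here refl))
        | rank-≡0 (1 + v ∷ v ∷ 1 + v ∷ v ∷ []) v (n≤1+n v ∷ ≤-refl ∷ n≤1+n v ∷ ≤-refl ∷ []) = refl

peel-221/1 : ∀ w S → IsPartition (2 + suc w ∷ 2 + suc w ∷ 1 + suc w ∷ S) → row S 0 ≤ suc w →
  Peel IsNVTetromino (2 + suc w ∷ 2 + suc w ∷ 1 + suc w ∷ S) (1 + suc w ∷ suc w ∷ suc w ∷ S)
peel-221/1 w S P S≤ =
  partition-∷ (n≤1+n _) (s≤s z≤n) (partition-∷ ≤-refl (s≤s z≤n)
    (partition-∷ S≤ (s≤s z≤n) (partition-tail (partition-tail (partition-tail P))))) ,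
  ∷⊆ (n≤1+n _) (∷⊆ (m≤n+m _ 2) (∷⊆ (n≤1+n _) (⊆ₚ-refl S))) ,
  inj₂ (inj₂ (inj₁ (skew⇒ShapeIs (2 + v ∷ 2 + v ∷ 1 + v ∷ S) (1 + v ∷ v ∷ v ∷ S) _ t-221/1 boxes (compress-221/1 v))))
  where
  v : ℕ
  v = suc w
  boxes : skew (2 + v ∷ 2 + v ∷ 1 + v ∷ S) (1 + v ∷ v ∷ v ∷ S) ≡ (0 , 1 + v) ∷ (1 , v) ∷ (1 , 1 + v) ∷ (2 , v) ∷ []
  boxes rewrite range-+ (suc v) 1 | range-+ v 2 | range-+ v 1 | skewFrom-self 3 S = refl

peel-[2,2,1] : Peel IsNVTetromino (2 ∷ 2 ∷ 1 ∷ []) (1 ∷ [])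
peel-[2,2,1] = ([-] , s≤s z≤n ∷ []) , ∷⊆ (s≤s z≤n) []⊆ ,
  inj₂ (inj₂ (inj₁ (compress⇒ShapeIs (skew (2 ∷ 2 ∷ 1 ∷ []) (1 ∷ [])) t-221/1 refl)))

compress-31 : ∀ c → compress ((0 , c) ∷ (0 , 1 + c) ∷ (0 , 2 + c) ∷ (1 , c) ∷ []) ≡ t-31
compress-31 c
  rewrite rank-suc-∈ (c ∷ 1 + c ∷ 2 + c ∷ c ∷ []) (1 + c) (there (here refl))
        | rank-suc-∈ (c ∷ 1 + c ∷ 2 + c ∷ c ∷ []) c (here refl)
        | rank-≡0 (c ∷ 1 + c ∷ 2 + c ∷ c ∷ []) c (≤-refl ∷ n≤1+n c ∷ m≤n+m c 2 ∷ ≤-refl ∷ []) = refl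

peel-31 : ∀ c S → IsPartition (3 + suc c ∷ 1 + suc c ∷ S) → row S 0 ≤ suc c →
  Peel IsNVTetromino (3 + suc c ∷ 1 + suc c ∷ S) (suc c ∷ suc c ∷ S)
peel-31 c S P S≤ =
  partition-∷ ≤-refl (s≤s z≤n) (partition-∷ S≤ (s≤s z≤n) (partition-tail (partition-tail P))) ,
  ∷⊆ (m≤n+m _ 3) (∷⊆ (n≤1+n _) (⊆ₚ-refl S)) ,
  inj₂ (inj₂ (inj₂ (inj₁ (skew⇒ShapeIs (3 + suc c ∷ 1 + suc c ∷ S) (suc c ∷ suc c ∷ S) _ t-31 boxes (compress-31 (suc c))))))
  where
  boxes : skew (3 + suc c ∷ 1 + suc c ∷ S) (suc c ∷ suc c ∷ S) ≡ (0 , suc c) ∷ (0 , 2 + c) ∷ (0 , 3 + c) ∷ (1 , suc c) ∷ []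
  boxes rewrite range-+ (suc c) 3 | range-+ (suc c) 1 | skewFrom-self 2 S = refl

peel-[3,1] : Peel IsNVTetromino (3 ∷ 1 ∷ []) []
peel-[3,1] = ([] , []) , []⊆ , inj₂ (inj₂ (inj₂ (inj₁ (compress⇒ShapeIs (skew (3 ∷ 1 ∷ []) []) t-31 refl))))

compress-vv : ∀ L → compress ((0 , 1) ∷ (1 , 1) ∷ (2 + L , 0) ∷ (3 + L , 0) ∷ []) ≡ t-vv
compress-vv L
  rewrite rank-suc-∈ (0 ∷ 1 ∷ 2 + L ∷ 3 + L ∷ []) (2 + L) (there (there (here refl)))
        | rank-gap (0 ∷ 1 ∷ 2 + L ∷ 3 + L ∷ []) 2 L
            (inj₁ (s≤s z≤n) ∷ inj₁ (s≤s (s≤s z≤n)) ∷ inj₂ ≤-refl ∷ inj₂ (n≤1+n _) ∷ []) = refl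

peel-vv : ∀ Q → IsPartition (2 ∷ 2 ∷ Q ++ 1 ∷ 1 ∷ []) → row (Q ++ 1 ∷ 1 ∷ []) 0 ≤ 1 →
  Peel IsNVTetromino (2 ∷ 2 ∷ Q ++ 1 ∷ 1 ∷ []) (1 ∷ 1 ∷ Q)
peel-vv Q P Q≤ =
  partition-∷ ≤-refl (s≤s z≤n)
    (partition-∷ (≤-trans (row-++ Q _) Q≤) (s≤s z≤n) (partition-prefix Q _ (partition-tail (partition-tail P)))) ,
  ∷⊆ (s≤s z≤n) (∷⊆ (s≤s z≤n) (prefix-⊆ₚ Q _)) ,
  inj₂ (inj₂ (inj₂ (inj₂ (inj₂ (inj₂ (inj₁
    (skew⇒ShapeIs (2 ∷ 2 ∷ Q ++ 1 ∷ 1 ∷ []) (1 ∷ 1 ∷ Q) _ t-vv boxes (compress-vv (length Q)))))))))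
  where
  boxes : skew (2 ∷ 2 ∷ Q ++ 1 ∷ 1 ∷ []) (1 ∷ 1 ∷ Q) ≡ (0 , 1) ∷ (1 , 1) ∷ (2 + length Q , 0) ∷ (3 + length Q , 0) ∷ []
  boxes rewrite skewFrom-prefix 2 Q (1 ∷ 1 ∷ []) = refl

compress-hv : ∀ y L → compress ((0 , suc y) ∷ (0 , 2 + y) ∷ (1 + L , 0) ∷ (2 + L , 0) ∷ []) ≡ t-hv
compress-hv y L
  rewrite rank-suc-∈ (0 ∷ 0 ∷ 1 + L ∷ 2 + L ∷ []) (1 + L) (there (there (here refl)))
        | rank-gap (0 ∷ 0 ∷ 1 + L ∷ 2 + L ∷ []) 1 L (inj₁ (s≤s z≤n) ∷ inj₁ (s≤s z≤n) ∷ inj₂ ≤-refl ∷ inj₂ (n≤1+n _) ∷ [])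
        | rank-suc-∈ (suc y ∷ 2 + y ∷ 0 ∷ 0 ∷ []) (suc y) (here refl)
        | rank-gap (suc y ∷ 2 + y ∷ 0 ∷ 0 ∷ []) 1 y (inj₂ ≤-refl ∷ inj₂ (n≤1+n _) ∷ inj₁ (s≤s z≤n) ∷ inj₁ (s≤s z≤n) ∷ []) = refl

peel-hv : ∀ y Q → IsPartition (2 + suc y ∷ Q ++ 1 ∷ 1 ∷ []) → row (Q ++ 1 ∷ 1 ∷ []) 0 ≤ suc y →
  Peel IsNVTetromino (2 + suc y ∷ Q ++ 1 ∷ 1 ∷ []) (suc y ∷ Q)
peel-hv y Q P Q≤ =
  partition-∷ (≤-trans (row-++ Q _) Q≤) (s≤s z≤n) (partition-prefix Q _ (partition-tail P)) ,
  ∷⊆ (m≤n+m _ 2) (prefix-⊆ₚ Q _) ,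
  inj₂ (inj₂ (inj₂ (inj₂ (inj₂ (inj₂ (inj₂ (inj₁
    (skew⇒ShapeIs (2 + suc y ∷ Q ++ 1 ∷ 1 ∷ []) (suc y ∷ Q) _ t-hv boxes (compress-hv y (length Q))))))))))
  where
  boxes : skew (2 + suc y ∷ Q ++ 1 ∷ 1 ∷ []) (suc y ∷ Q) ≡ (0 , suc y) ∷ (0 , 2 + y) ∷ (1 + length Q , 0) ∷ (2 + length Q , 0) ∷ []
  boxes rewrite range-+ (suc y) 2 | skewFrom-prefix 1 Q (1 ∷ 1 ∷ []) = refl

compress-hh : ∀ u g L →
  compress ((0 , 2 + u + g) ∷ (0 , 3 + u + g) ∷ (1 + L , u) ∷ (1 + L , suc u) ∷ []) ≡ t-hh
compress-hh u g L
  rewrite rank-gap (0 ∷ 0 ∷ 1 + L ∷ 1 + L ∷ []) 1 L (inj₁ (s≤s z≤n) ∷ inj₁ (s≤s z≤n) ∷ inj₂ ≤-refl ∷ inj₂ ≤-refl ∷ [])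
        | rank-suc-∈ (2 + u + g ∷ 3 + u + g ∷ u ∷ suc u ∷ []) (2 + u + g) (here refl)
        | rank-gap (2 + u + g ∷ 3 + u + g ∷ u ∷ suc u ∷ []) (2 + u) g
            (inj₂ ≤-refl ∷ inj₂ (n≤1+n _) ∷ inj₁ (m<n+m u (s≤s z≤n)) ∷ inj₁ (n<1+n (suc u)) ∷ [])
        | rank-suc-∈ (2 + u + g ∷ 3 + u + g ∷ u ∷ suc u ∷ []) (suc u) (there (there (there (here refl))))
        | rank-suc-∈ (2 + u + g ∷ 3 + u + g ∷ u ∷ suc u ∷ []) u (there (there (here refl)))
        | rank-≡0 (2 + u + g ∷ 3 + u + g ∷ u ∷ suc u ∷ []) u
            (≤-trans (m≤m+n u g) (m≤n+m (u + g) 2) ∷ ≤-trans (m≤m+n u g) (m≤n+m (u + g) 3) ∷ ≤-refl ∷ n≤1+n u ∷ [])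
        = refl

peel-hh : ∀ u g Q S → IsPartition (4 + suc u + g ∷ Q ++ 2 + suc u ∷ S) →
  row (Q ++ 2 + suc u ∷ S) 0 ≤ 2 + suc u + g → row S 0 ≤ suc u →
  Peel IsNVTetromino (4 + suc u + g ∷ Q ++ 2 + suc u ∷ S) (2 + suc u + g ∷ Q ++ suc u ∷ S)
peel-hh u g Q S P Q≤ S≤ =
  partition-∷ (≤-trans (row-replace Q S (m≤n+m _ 2)) Q≤) (s≤s z≤n)
    (partition-replace Q S (partition-tail P) (m≤n+m _ 2) S≤ (s≤s z≤n)) ,
  ∷⊆ (m≤n+m _ 2) (++⁺-⊆ₚ Q (∷⊆ (m≤n+m _ 2) (⊆ₚ-refl S))) ,
  inj₂ (inj₂ (inj₂ (inj₂ (inj₂ (inj₁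
    (skew⇒ShapeIs (4 + suc u + g ∷ Q ++ 2 + suc u ∷ S) (2 + suc u + g ∷ Q ++ suc u ∷ S) _ t-hh boxes
                  (compress-hh (suc u) g (length Q))))))))
  where
  boxes : skew (4 + suc u + g ∷ Q ++ 2 + suc u ∷ S) (2 + suc u + g ∷ Q ++ suc u ∷ S) ≡
          (0 , 2 + suc u + g) ∷ (0 , 3 + suc u + g) ∷ (1 + length Q , suc u) ∷ (1 + length Q , 2 + u) ∷ []
  boxes rewrite range-+ (2 + suc u + g) 2 | skewFrom-++ 1 Q (2 + suc u ∷ S) (suc u ∷ S) | range-+ (suc u) 2
              | skewFrom-self (2 + length Q) S = refl

peel-hh-bottom : ∀ g Q → IsPartition (4 + g ∷ Q ++ 2 ∷ []) → row (Q ++ 2 ∷ []) 0 ≤ 2 + g →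
  Peel IsNVTetromino (4 + g ∷ Q ++ 2 ∷ []) (2 + g ∷ Q)
peel-hh-bottom g Q P Q≤ =
  partition-∷ (≤-trans (row-++ Q _) Q≤) (s≤s z≤n) (partition-prefix Q _ (partition-tail P)) ,
  ∷⊆ (m≤n+m _ 2) (prefix-⊆ₚ Q _) ,
  inj₂ (inj₂ (inj₂ (inj₂ (inj₂ (inj₁
    (skew⇒ShapeIs (4 + g ∷ Q ++ 2 ∷ []) (2 + g ∷ Q) _ t-hh boxes (compress-hh 0 g (length Q))))))))
  where
  boxes : skew (4 + g ∷ Q ++ 2 ∷ []) (2 + g ∷ Q) ≡ (0 , 2 + g) ∷ (0 , 3 + g) ∷ (1 + length Q , 0) ∷ (1 + length Q , 1) ∷ []
  boxes rewrite range-+ (2 + g) 2 | skewFrom-prefix 1 Q (2 ∷ []) = refl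

-- Classification.

data Classification (la : List ℕ) : Set where
  empty       : la ≡ [] → Classification la
  stairColumn : ∀ m a → la ≡ stair (suc m) ++ replicate a 1 → Classification la
  raisedStair : ∀ u i → la ≡ raised u (suc i) → Classification la
  peelable    : ∀ mu → Peel IsNVTetromino la mu → Classification la

peelableAs : ∀ {la} la′ mu → la′ ≡ la → IsPartition la →
  (IsPartition la′ → Peel IsNVTetromino la′ mu) → Classification la
peelableAs la′ mu refl P peel = peelable mu (peel P)

peel-longRow : ∀ e k S → IsPartition (4 + e + suc k ∷ S) → row S 0 ≤ suc k →
  Peel IsNVTetromino (4 + e + suc k ∷ S) (e + suc k ∷ S)
peel-longRow e k S P S≤ rewrite +-suc e k = peel-row (e + k) S P (≤-trans S≤ (s≤s (m≤n+m k e)))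

replicate-∷ʳ : ∀ a → 1 ∷ 1 ∷ replicate a 1 ≡ replicate a 1 ++ 1 ∷ 1 ∷ []
replicate-∷ʳ zero    = refl
replicate-∷ʳ (suc a) = cong (1 ∷_) (replicate-∷ʳ a)

stairColumn-∷ʳ : ∀ m a → Σ (List ℕ) λ Q → stair (suc m) ++ replicate (suc a) 1 ≡ Q ++ 1 ∷ 1 ∷ []
stairColumn-∷ʳ zero    a = replicate a 1 , replicate-∷ʳ a
stairColumn-∷ʳ (suc m) a with stairColumn-∷ʳ m a
... | Q , eq = 2 + m ∷ Q , cong (2 + m ∷_) eq

classify-[_] : ∀ x → IsPartition (x ∷ []) → Classification (x ∷ [])
classify-[ zero ] (_ , () ∷ _)
classify-[ 1 ] _ = stairColumn 0 0 refl
classify-[ 2 ] _ = raisedStair 0 0 refl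
classify-[ 3 ] _ = raisedStair 1 0 refl
classify-[ 4 ] _ = peelable [] peel-[4]
classify-[ suc (suc (suc (suc (suc c)))) ] P = peelable (suc c ∷ []) (peel-row c [] P z≤n)

classify-above-stairColumn : ∀ d m a → IsPartition (d + suc m ∷ stair (suc m) ++ replicate a 1) →
  Classification (d + suc m ∷ stair (suc m) ++ replicate a 1)
classify-above-stairColumn 0 0 a _ = stairColumn 0 (suc a) refl
classify-above-stairColumn 0 1 0 _ = peelable (1 ∷ []) peel-[2,2,1]
classify-above-stairColumn 0 1 (suc a) P =
  peelableAs (2 ∷ 2 ∷ replicate a 1 ++ 1 ∷ 1 ∷ []) (1 ∷ 1 ∷ replicate a 1) (cong (λ xs → 2 ∷ 2 ∷ xs) (sym (replicate-∷ʳ a))) P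
    (λ P′ → peel-vv (replicate a 1) P′ (subst (λ xs → row xs 0 ≤ 1) (replicate-∷ʳ a) ≤-refl))
classify-above-stairColumn 0 (suc (suc w)) a P = peelable _ (peel-221/1 w (stair (suc w) ++ replicate a 1) P ≤-refl)
classify-above-stairColumn 1 m a _ = stairColumn (suc m) a refl
classify-above-stairColumn 2 0 0 _ = peelable [] peel-[3,1]
classify-above-stairColumn 2 0 (suc a) P =
  peelableAs (3 ∷ replicate a 1 ++ 1 ∷ 1 ∷ []) (1 ∷ replicate a 1) (cong (3 ∷_) (sym (replicate-∷ʳ a))) P
    (λ P′ → peel-hv 0 (replicate a 1) P′ (subst (λ xs → row xs 0 ≤ 1) (replicate-∷ʳ a) ≤-refl))
classify-above-stairColumn 2 (suc w) a P = peelable _ (peel-31 w (stair (suc w) ++ replicate a 1) P ≤-refl)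
classify-above-stairColumn 3 m 0 _ =
  raisedStair (2 + m) 0 (cong₂ _∷_ (cong (λ k → 4 + k) (sym (+-identityʳ m))) (++-identityʳ _))
classify-above-stairColumn 3 m (suc a) P with stairColumn-∷ʳ m a
... | Q , eq = peelableAs (4 + m ∷ Q ++ 1 ∷ 1 ∷ []) (2 + m ∷ Q) (cong (4 + m ∷_) (sym eq)) P
                 (λ P′ → peel-hv (suc m) Q P′ (subst (λ xs → row xs 0 ≤ 2 + m) eq (n≤1+n _)))
classify-above-stairColumn (suc (suc (suc (suc e)))) m a P = peelable _ (peel-longRow e m _ P ≤-refl)

classify-above-raised : ∀ d u i → IsPartition (d + (2 + u + i) ∷ raised u (suc i)) →
  Classification (d + (2 + u + i) ∷ raised u (suc i))
classify-above-raised 0 0 0 _ = peelable [] peel-[2,2]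
classify-above-raised 0 (suc c) 0 P =
  peelableAs (3 + c ∷ 3 + c ∷ stair c) (suc c ∷ suc c ∷ stair c) (cong (λ k → 3 + k ∷ 3 + k ∷ stair c) (sym (+-identityʳ c))) P
    (λ P′ → peel-square c (stair c) P′ (≤-trans (≤-reflexive (row-stair c)) (n≤1+n c)))
classify-above-raised 0 u (suc i) P =
  peelableAs (3 + u + i ∷ 3 + u + i ∷ 2 + u + i ∷ raised u i) (2 + u + i ∷ suc (u + i) ∷ suc (u + i) ∷ raised u i)
    (cong (λ k → suc (suc k) ∷ suc (suc k) ∷ 2 + u + i ∷ raised u i) (sym (+-suc u i))) P
    (λ P′ → peel-221/1 (u + i) (raised u i) P′ (row-raised u i))
classify-above-raised 1 u i _ = raisedStair u (suc i) (cong (_∷ raised u (suc i)) (sym (+-suc (2 + u) i)))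
classify-above-raised 2 u i P = peelable _ (peel-31 (u + i) (raised u i) P (row-raised u i))
classify-above-raised 3 0 i P =
  peelableAs (4 + suc i ∷ descending 3 i ++ 2 ∷ []) (2 + suc i ∷ descending 3 i) (cong (5 + i ∷_) (sym (raised-suc 0 i))) P
    (λ P′ → peel-hh-bottom (suc i) (descending 3 i) P′ (subst (λ xs → row xs 0 ≤ 3 + i) (raised-suc 0 i) (n≤1+n _)))
classify-above-raised 3 (suc u) i P =
  peelableAs (4 + suc u + suc i ∷ descending (4 + u) i ++ 2 + suc u ∷ stair u)
             (2 + suc u + suc i ∷ descending (4 + u) i ++ suc u ∷ stair u)
    (cong₂ _∷_ (cong (λ k → 5 + k) (+-suc u i)) (sym (raised-suc (suc u) i))) P
    (λ P′ → peel-hh u (suc i) (descending (4 + u) i) (stair u) P′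
              (subst (λ xs → row xs 0 ≤ 2 + suc u + suc i) (raised-suc (suc u) i)
                     (≤-trans (n≤1+n _) (≤-reflexive (cong (λ k → 3 + k) (sym (+-suc u i))))))
              (≤-trans (≤-reflexive (row-stair u)) (n≤1+n u)))
classify-above-raised (suc (suc (suc (suc e)))) u i P = peelable _ (peel-longRow e (suc (u + i)) _ P ≤-refl)

split-≤ : ∀ {k x} → k ≤ x → Σ ℕ λ d → x ≡ d + k
split-≤ {k} k≤x with m≤n⇒∃[o]m+o≡n k≤x
... | d , eq = d , trans (sym eq) (+-comm k d)

classify : ∀ la → IsPartition la → Classification la
classify []       _ = empty refl
classify (x ∷ la) P@(la↓ , x>0 ∷ _) with classify la (partition-tail P)
... | peelable mu peel = peelable (x ∷ mu) (peelTetromino-∷ x la mu (row-tail≤head la↓) x>0 peel)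
... | empty refl = classify-[ x ] P
... | stairColumn m a refl with split-≤ (row-tail≤head la↓)
...   | d , refl = classify-above-stairColumn d m a P
classify (x ∷ la) P@(la↓ , _) | raisedStair u i refl with split-≤ (row-tail≤head la↓)
...   | d , refl = classify-above-raised d u i P

length-descending-++ : ∀ t i X → i ≤ length (descending t i ++ X)
length-descending-++ t zero    X = z≤n
length-descending-++ t (suc i) X = s≤s (length-descending-++ t i X)

descending≥2 : ∀ u i → All (_≥ 2) (descending (2 + u) i)
descending≥2 u zero    = []
descending≥2 u (suc i) = s≤s (s≤s z≤n) ∷ descending≥2 u i

lemma4p2 : (la : List ℕ) → IsPartition la → TetNumberZero la →
    (Σ ℕ λ m → Σ ℕ λ a → la ≡ stair m ++ replicate a 1)
    ⊎ (Σ ℕ λ i → 1 ≤ i × i ≤ length la × All (λ x → x ≥ 2) (take i la)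
    × StaircaseOf la (peelRows i la))
lemma4p2 la P s≡0 with classify la P
... | empty refl           = inj₁ (0 , 0 , refl)
... | stairColumn m a refl = inj₁ (suc m , a , refl)
... | raisedStair u i refl =
  inj₂ (suc i , s≤s z≤n , length-descending-++ (2 + u) (suc i) _ ,
        subst (All (_≥ 2)) (sym (take-descending (2 + u) (suc i) _)) (descending≥2 u (suc i)) ,
        staircaseOf-raised u (suc i))
... | peelable mu peel with () ← s≡0 mu 1 (step peel done)
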